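{- Let $(S,+,0,\bullet,1)$ be a partial commutative semiring satisfying the standing assumptions below, $FX=\coprod_{\lambda\in\Lambda}X^{\mathrm{ar}(\lambda)}$, and $(C,\gamma)$ a $\mathsf{T}_S\circ F$-coalgebra. For every $c\in C$, $\mathcal M_c$ is a $\sigma$-algebra on $\mathsf{Paths}_c$.
   Context: A partial commutative semiring is a tuple $(S,+,0,\bullet,1)$ where $+$ is a partial binary operation on $S$, commutative and associative whenever defined, with unit $0$; $(S,\bullet,1)$ is a commutative monoid; $s\bullet 0=0$; and whenever $t+u$ is defined, $s\bullet t+s\bullet u$ is defined and equals $s\bullet(t+u)$. Define $x\sqsubseteq y$ iff $x+z=y$ for some $z$. Standing assumptions: $\sqsubseteq$ is a partial order in which increasing $\omega$-chains have suprema and decreasing $\omega$-chains have infima, $1$ is the top element, $+$ and $\bullet$ preserve suprema of increasing and infima of decreasing $\omega$-chains in each argument; and $(S,\sqsubseteq)$ is a complete lattice. $\mathsf{T}_SX$ is the set of $\varphi:X\to S$ with finite support such that the sum of values is defined. $\Lambda$ is a set of symbols with arities $\mathrm{ar}(\lambda)\in\mathbb N$; elements of $FX$ are written $\iota_\lambda(x_1,\dots,x_{\mathrm{ar}(\lambda)})$; a $\mathsf{T}_S\circ F$-coalgebra is a map $\gamma:C\to\mathsf{T}_S(FC)$. A path is a possibly infinite ordered tree each node of which is labelled by $(d,\lambda)\in C\times\Lambda$ and has exactly $\mathrm{ar}(\lambda)$ children. A path from $c$ in $(C,\gamma)$ has root labelled $(c,\lambda)$ for some $\lambda$ and at every node labelled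 $(d,\lambda)$ whose children have root states $d_1,\dots,d_n$ satisfies $\gamma(d)(\iota_\lambda(d_1,\dots,d_n))\neq0$; $\mathsf{Paths}_c$ is the set of these. If $\gamma(c)(\iota_\lambda(c_1,\dots,c_n))\neq0$ and $P_i\subseteq\mathsf{Paths}_{c_i}$, let $(c,\lambda)(c_1,\dots,c_n)[P_1,\dots,P_n]$ be the set of paths with root $(c,\lambda)$ whose $i$-th child subtree lies in $P_i$. The families $\mathcal M_c$ ($c\in C$) are the least families of subsets of $\mathsf{Paths}_c$ such that: $\mathsf{Paths}_c\in\mathcal M_c$; $(c,\lambda)(c_1,\dots,c_n)[P_1,\dots,P_n]\in\mathcal M_c$ whenever $\gamma(c)(\iota_\lambda(c_1,\dots,c_n))\neq0$ and $P_i\in\mathcal M_{c_i}$; $\mathcal M_c$ is closed under finite unions of pairwise disjoint sets, under unions of increasing $\omega$-chains, and under intersections of decreasing $\omega$-chains. -}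

module Defs where

open import Level using (0ℓ)
open import Data.Nat using (ℕ; suc; _<_; _≤_)
open import Data.Fin using (Fin; toℕ)
open import Data.Vec using (Vec; tabulate; lookup)
open import Data.List using (List; []; _∷_; map; _++_; [_])
open import Data.List.Membership.Propositional using (_∈_)
open import Data.List.Relation.Unary.Unique.Propositional using (Unique)
open import Data.Maybe using (Maybe; just; nothing; _>>=_; Is-just)
open import Data.Product using (Σ; ∃; _×_; _,_; proj₁)
open import Function using (_∘_)
open import Relation.Nullary using (¬_)
open import Relation.Unary using (Pred; _⊆_; _⊇_; _≐_)
open import Relation.Binary.Structures using (IsPartialOrder)
open import Relation.Binary.PropositionalEquality using (_≡_; _≢_; subst)

-- Partial commutative semirings.  The partial addition is a function
-- into Maybe (nothing = undefined).

record PCSemiring : Set₁ where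
  infixl 6 _⊕_
  infixl 7 _•_
  field
    Carrier : Set
    _⊕_     : Carrier → Carrier → Maybe Carrier
    𝟘 𝟙     : Carrier
    _•_     : Carrier → Carrier → Carrier
    -- + commutative, associative whenever defined (Kleene equality), unit 0
    ⊕-comm      : ∀ x y → x ⊕ y ≡ y ⊕ x
    ⊕-assoc     : ∀ x y z → ((x ⊕ y) >>= (_⊕ z)) ≡ ((y ⊕ z) >>= (x ⊕_))
    ⊕-identityʳ : ∀ x → x ⊕ 𝟘 ≡ just x
    •-comm      : ∀ x y → x • y ≡ y • x
    •-assoc     : ∀ x y z → (x • y) • z ≡ x • (y • z)
    •-identityʳ : ∀ x → x • 𝟙 ≡ x
    •-zeroʳ     : ∀ s → s • 𝟘 ≡ 𝟘
    distrib     : ∀ s t u v → t ⊕ u ≡ just v → (s • t) ⊕ (s • u) ≡ just (s • v)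

module Order (𝕊 : PCSemiring) where
  open PCSemiring 𝕊

  _⊑_ : Carrier → Carrier → Set
  x ⊑ y = ∃ λ z → x ⊕ z ≡ just y

  Increasing : (ℕ → Carrier) → Set
  Increasing a = ∀ n → a n ⊑ a (suc n)

  Decreasing : (ℕ → Carrier) → Set
  Decreasing a = ∀ n → a (suc n) ⊑ a n

  IsSup : (ℕ → Carrier) → Carrier → Set
  IsSup a x = (∀ n → a n ⊑ x) × (∀ y → (∀ n → a n ⊑ y) → x ⊑ y)

  IsInf : (ℕ → Carrier) → Carrier → Set
  IsInf a x = (∀ n → x ⊑ a n) × (∀ y → (∀ n → y ⊑ a n) → y ⊑ x)

  IsLub : Pred Carrier 0ℓ → Carrier → Set
  IsLub A x = (∀ y → A y → y ⊑ x) × (∀ z → (∀ y → A y → y ⊑ z) → x ⊑ z)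

record Standing (𝕊 : PCSemiring) : Set₁ where
  open PCSemiring 𝕊
  open Order 𝕊
  field
    ⊑-partialOrder : IsPartialOrder _≡_ _⊑_
    incr-sup : ∀ a → Increasing a → ∃ (IsSup a)
    decr-inf : ∀ a → Decreasing a → ∃ (IsInf a)
    𝟙-top    : ∀ x → x ⊑ 𝟙
    ⊕-supˡ : ∀ a b s x y → Increasing a → (∀ n → a n ⊕ b ≡ just (s n)) →
             IsSup a x → IsSup s y → x ⊕ b ≡ just y
    ⊕-supʳ : ∀ a b s x y → Increasing a → (∀ n → b ⊕ a n ≡ just (s n)) →
             IsSup a x → IsSup s y → b ⊕ x ≡ just y
    ⊕-infˡ : ∀ a b s x y → Decreasing a → (∀ n → a n ⊕ b ≡ just (s n)) →
             IsInf a x → IsInf s y → x ⊕ b ≡ just y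
    ⊕-infʳ : ∀ a b s x y → Decreasing a → (∀ n → b ⊕ a n ≡ just (s n)) →
             IsInf a x → IsInf s y → b ⊕ x ≡ just y
    •-supˡ : ∀ a b x → Increasing a → IsSup a x → IsSup (λ n → a n • b) (x • b)
    •-supʳ : ∀ a b x → Increasing a → IsSup a x → IsSup (λ n → b • a n) (b • x)
    •-infˡ : ∀ a b x → Decreasing a → IsInf a x → IsInf (λ n → a n • b) (x • b)
    •-infʳ : ∀ a b x → Decreasing a → IsInf a x → IsInf (λ n → b • a n) (b • x)
    complete : ∀ (A : Pred Carrier 0ℓ) → ∃ (IsLub A)

module _ (𝕊 : PCSemiring) where
  open PCSemiring 𝕊

  sumL : List Carrier → Maybe Carrier
  sumL []       = just 𝟘
  sumL (x ∷ xs) = sumL xs >>= (x ⊕_)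

  TS : Set → Set
  TS X = Σ (X → Carrier) λ φ →
           ∃ λ (supp : List X) → Unique supp ×
             (∀ x → φ x ≢ 𝟘 → x ∈ supp) × Is-just (sumL (map φ supp))

-- The polynomial functor F X = ∐_{λ ∈ Λ} X^{ar λ}; ι λ xs = (λ , xs).
FObj : (Λ : Set) → (Λ → ℕ) → Set → Set
FObj Λ ar X = Σ Λ λ l → Vec X (ar l)

record IsSigmaAlgebra {A : Set} (X : Pred A 0ℓ) (𝒜 : Pred A 0ℓ → Set₁) : Set₁ where
  field
    subsets : ∀ P → 𝒜 P → P ⊆ X
    whole   : 𝒜 X
    compl   : ∀ P → 𝒜 P → 𝒜 (λ t → X t × ¬ P t)
    ⋃-count : ∀ (P : ℕ → Pred A 0ℓ) → (∀ n → 𝒜 (P n)) → 𝒜 (λ t → ∃ λ n → P n t)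

module Paths (𝕊 : PCSemiring) {Λ : Set} (ar : Λ → ℕ) {C : Set}
             (γ : C → TS 𝕊 (FObj Λ ar C)) where
  open PCSemiring 𝕊

  -- Possibly infinite ordered trees labelled in C × Λ, represented by their
  -- node labelling: addresses are root-first lists of child indices; the
  -- i-th child of the node at address p sits at address p ++ [ i ].
  Addr : Set
  Addr = List ℕ

  Tree : Set
  Tree = Addr → Maybe (C × Λ)

  record WellFormed (t : Tree) : Set where
    field
      root      : ∃ λ x → t [] ≡ just x
      children  : ∀ p d l → t p ≡ just (d , l) → ∀ i →
                  (i < ar l → Is-just (t (p ++ [ i ]))) ×
                  (ar l ≤ i → t (p ++ [ i ]) ≡ nothing)
      no-orphan : ∀ p i → t p ≡ nothing → t (p ++ [ i ]) ≡ nothing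

  subtree : Tree → ℕ → Tree
  subtree t i p = t (i ∷ p)

  PathsFrom : C → Pred Tree 0ℓ
  PathsFrom c t = WellFormed t × (∃ λ l → t [] ≡ just (c , l)) ×
    (∀ p d l → t p ≡ just (d , l) → (ds : Vec C (ar l)) →
       (∀ i → ∃ λ l′ → t (p ++ [ toℕ i ]) ≡ just (lookup ds i , l′)) →
       proj₁ (γ d) (l , ds) ≢ 𝟘)

  Cyl : (c : C) (l : Λ) → (Fin (ar l) → Pred Tree 0ℓ) → Pred Tree 0ℓ
  Cyl c l Ps t = PathsFrom c t × t [] ≡ just (c , l) ×
    (∀ i → Ps i (subtree t (toℕ i)))

  -- Least families 𝓜_c; sets are predicates up to extensional equality.
  data 𝓜 : C → Pred Tree 0ℓ → Set₁ where
    whole : ∀ c → 𝓜 c (PathsFrom c)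
    cyl   : ∀ c l (cs : Vec C (ar l)) (Ps : Fin (ar l) → Pred Tree 0ℓ) →
            proj₁ (γ c) (l , cs) ≢ 𝟘 →
            (∀ i → 𝓜 (lookup cs i) (Ps i)) → 𝓜 c (Cyl c l Ps)
    disj  : ∀ c k (Ps : Fin k → Pred Tree 0ℓ) → (∀ i → 𝓜 c (Ps i)) →
            (∀ i j → i ≢ j → ∀ t → Ps i t → ¬ Ps j t) →
            𝓜 c (λ t → ∃ λ i → Ps i t)
    incr  : ∀ c (Ps : ℕ → Pred Tree 0ℓ) → (∀ n → Ps n ⊆ Ps (suc n)) →
            (∀ n → 𝓜 c (Ps n)) → 𝓜 c (λ t → ∃ λ n → Ps n t)
    decr  : ∀ c (Ps : ℕ → Pred Tree 0ℓ) → (∀ n → Ps n ⊇ Ps (suc n)) →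
            (∀ n → 𝓜 c (Ps n)) → 𝓜 c (λ t → ∀ n → Ps n t)
    ext   : ∀ c P Q → P ≐ Q → 𝓜 c P → 𝓜 c Q

module Submission where

-- Members of 𝓜_c are sets
-- of paths from c and Paths_c ∈ 𝓜_c, so what remains is closure under
-- relative complement and countable unions; the argument is classical.
--   * Shapes: a path from c has a unique shape x ∈ F C (root label and the
--     root states of its children).  Shape sets lie in 𝓜_c, and so do their
--     complements: the disjoint union of the other shapes in the finite
--     support of γ(c).
--   * 𝓜_c is closed under binary intersection (induction on both
--     derivations; cylinders of different shapes are disjoint).
--   * 𝓜_c is closed under relative complement (induction on the
--     derivation): a cylinder is its shape intersected with finitely many
--     one-coordinate cylinders, whose complements are explicit; the other
--     cases are De Morgan's laws.
--   * A countable union is the increasing union of its disjointified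
--     partial unions.
-- Only the support of γ(c) matters; the standing assumptions are unused.

open import Defs
open import Data.Nat using (ℕ)
open import Axiom.ExcludedMiddle using (ExcludedMiddle)
open import Axiom.DoubleNegationElimination using (em⇒dne)
open import Level using (0ℓ)
open import Data.Nat using (suc; zero)
open import Data.Fin using (Fin; toℕ; zero; suc) renaming (_≟_ to _≟ᶠ_)
open import Data.Fin.Properties using (toℕ<n)
open import Data.Vec using (Vec; lookup; tabulate)
open import Data.Vec.Properties using (tabulate∘lookup; tabulate-cong; lookup∘tabulate)
open import Data.List using (List; []; _∷_; length)
import Data.List as List
open import Data.List.Membership.Propositional using (_∈_)
open import Data.List.Relation.Unary.Any as Any using ()
open import Data.List.Relation.Unary.Any.Properties using (lookup-index)
import Data.List.Relation.Unary.All as All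
open import Data.List.Membership.Propositional.Properties using (∈-lookup)
open import Data.List.Relation.Unary.AllPairs using (_∷_)
open import Data.List.Relation.Unary.Unique.Propositional using (Unique)
open import Data.Maybe using (Maybe; just; Is-just)
import Data.Maybe.Relation.Unary.Any as Maybe
open import Data.Maybe.Properties using (just-injective)
open import Data.Product using (∃; _×_; _,_; proj₁; proj₂)
open import Data.Product.Properties using (,-injectiveˡ)
open import Data.Sum using (_⊎_; inj₁; inj₂)
open import Data.Empty using (⊥-elim)
open import Function using (_∘_)
open import Relation.Nullary using (¬_; Dec; yes; no)
open import Relation.Unary using (Pred; _⊆_; _∩_)
open import Relation.Binary.PropositionalEquality
  using (_≡_; _≢_; refl; sym; trans; cong; subst)

Is-just⇒≡just : ∀ {A : Set} {m : Maybe A} → Is-just m → ∃ λ a → m ≡ just a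
Is-just⇒≡just (Maybe.just _) = _ , refl

-- In a duplicate-free list, positions are determined by their entries;
-- this makes the shapes in the support of γ(c) pairwise disjoint.
Unique-lookup-injective : ∀ {A : Set} {xs : List A} → Unique xs →
  ∀ i j → List.lookup xs i ≡ List.lookup xs j → i ≡ j
Unique-lookup-injective (_ ∷ _) zero zero _ = refl
Unique-lookup-injective (x∉xs ∷ _) zero (suc j) e = ⊥-elim (All.lookup x∉xs (∈-lookup j) e)
Unique-lookup-injective u@(_ ∷ _) (suc i) zero e = sym (Unique-lookup-injective u zero (suc i) (sym e))
Unique-lookup-injective (_ ∷ u) (suc i) (suc j) e = cong suc (Unique-lookup-injective u i j e)

Vec-ext : ∀ {A : Set} {n} {xs ys : Vec A n} → (∀ i → lookup xs i ≡ lookup ys i) → xs ≡ ys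
Vec-ext {xs = xs} {ys} h = trans (sym (tabulate∘lookup xs)) (trans (tabulate-cong h) (tabulate∘lookup ys))

⋂-fin : ∀ {A : Set} {𝒜 : Pred A 0ℓ → Set₁} →
  (∀ {P Q} → 𝒜 P → P ⊆ Q → Q ⊆ P → 𝒜 Q) →
  (∀ {P Q} → 𝒜 P → 𝒜 Q → 𝒜 (P ∩ Q)) →
  ∀ k {B} (Cs : Fin k → Pred A 0ℓ) → 𝒜 B → (∀ i → 𝒜 (Cs i)) →
  𝒜 (λ t → B t × (∀ i → Cs i t))
⋂-fin resp _ zero Cs 𝒜B _ = resp 𝒜B (λ b → b , λ ()) proj₁
⋂-fin resp _∩𝒜_ (suc k) Cs 𝒜B 𝒜Cs =
  resp (⋂-fin resp _∩𝒜_ k (Cs ∘ suc) (𝒜B ∩𝒜 𝒜Cs zero) (𝒜Cs ∘ suc))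
       (λ ((b , c₀) , cs) → b , λ { zero → c₀ ; (suc i) → cs i })
       (λ (b , cs) → (b , cs zero) , cs ∘ suc)

module SigmaAlgebra (em : ∀ {ℓ} → ExcludedMiddle ℓ) (𝕊 : PCSemiring)
  {Λ : Set} (ar : Λ → ℕ) {C : Set} (γ : C → TS 𝕊 (FObj Λ ar C)) where
  open PCSemiring 𝕊
  open Paths 𝕊 ar γ

  Event : Set₁
  Event = Pred Tree 0ℓ

  decide : (X : Set) → Dec X
  decide X = em {0ℓ} {X}

  ∁[_]_ : C → Event → Event
  (∁[ c ] P) t = PathsFrom c t × ¬ P t

  weight : C → FObj Λ ar C → Carrier
  weight c = proj₁ (γ c)

  𝓜-resp : ∀ {c} {P Q : Event} → 𝓜 c P → P ⊆ Q → Q ⊆ P → 𝓜 c Q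
  𝓜-resp {c} {P} {Q} m P⊆Q Q⊆P = ext c P Q (P⊆Q , Q⊆P) m

  𝓜-∅ : ∀ {c} {P : Event} → (∀ {t} → ¬ P t) → 𝓜 c P
  𝓜-∅ {c} P-empty = 𝓜-resp (disj c 0 (λ ()) (λ ()) (λ ())) (λ { (() , _) }) (⊥-elim ∘ P-empty)

  𝓜⊆Paths : ∀ {c P} → 𝓜 c P → P ⊆ PathsFrom c
  𝓜⊆Paths (whole c) p = p
  𝓜⊆Paths (cyl c l cs Ps _ _) (p , _) = p
  𝓜⊆Paths (disj c k Ps m _) (i , p) = 𝓜⊆Paths (m i) p
  𝓜⊆Paths (incr c Ps _ m) (n , p) = 𝓜⊆Paths (m n) p
  𝓜⊆Paths (decr c Ps _ m) p = 𝓜⊆Paths (m 0) (p 0)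
  𝓜⊆Paths (ext c P Q (_ , Q⊆P) m) q = 𝓜⊆Paths m (Q⊆P q)

  𝓜-⊎ : ∀ {c} {P Q : Event} → 𝓜 c P → 𝓜 c Q → (∀ {t} → P t → ¬ Q t) →
        𝓜 c (λ t → P t ⊎ Q t)
  𝓜-⊎ {c} {P} {Q} mP mQ P∩Q=∅ = 𝓜-resp (disj c 2 F mF disjoint) to from
    where
    F : Fin 2 → Event
    F zero = P
    F (suc zero) = Q
    mF : ∀ i → 𝓜 c (F i)
    mF zero = mP
    mF (suc zero) = mQ
    disjoint : ∀ i j → i ≢ j → ∀ t → F i t → ¬ F j t
    disjoint zero zero i≢i = ⊥-elim (i≢i refl)
    disjoint zero (suc zero) _ _ p q = P∩Q=∅ p q
    disjoint (suc zero) zero _ _ q p = P∩Q=∅ p q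
    disjoint (suc zero) (suc zero) i≢i = ⊥-elim (i≢i refl)
    to : ∀ {t} → (∃ λ i → F i t) → P t ⊎ Q t
    to (zero , p) = inj₁ p
    to (suc zero , q) = inj₂ q
    from : ∀ {t} → P t ⊎ Q t → ∃ λ i → F i t
    from (inj₁ p) = zero , p
    from (inj₂ q) = suc zero , q

  record Shape (c : C) (x : FObj Λ ar C) (t : Tree) : Set where
    constructor shape
    field
      path     : PathsFrom c t
      root     : t [] ≡ just (c , proj₁ x)
      children : ∀ i → ∃ λ l′ → t (toℕ i ∷ []) ≡ just (lookup (proj₂ x) i , l′)

  shape-unique : ∀ {c x y t} → Shape c x t → Shape c y t → x ≡ y
  shape-unique {x = l , ds} {y = l′ , ds′} (shape _ root ch) (shape _ root′ ch′)
    with trans (sym root) root′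
  ... | refl = cong (l ,_) (Vec-ext λ i →
          ,-injectiveˡ (just-injective (trans (sym (proj₂ (ch i))) (proj₂ (ch′ i)))))

  path-shape : ∀ {c t} → PathsFrom c t → ∃ λ x → Shape c x t
  path-shape {c} {t} p@(wf , (l , root) , _) = (l , tabulate state) , shape p root child
    where
    child-label : (i : Fin (ar l)) → ∃ λ a → t (toℕ i ∷ []) ≡ just a
    child-label i = Is-just⇒≡just (proj₁ (WellFormed.children wf [] c l root (toℕ i)) (toℕ<n i))
    state : Fin (ar l) → C
    state i = proj₁ (proj₁ (child-label i))
    child : ∀ i → ∃ λ l′ → t (toℕ i ∷ []) ≡ just (lookup (tabulate state) i , l′)
    child i = proj₂ (proj₁ (child-label i)) ,
      trans (proj₂ (child-label i))
            (cong (λ d → just (d , proj₂ (proj₁ (child-label i)))) (sym (lookup∘tabulate state i)))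

  shape-weight≢0 : ∀ {c x t} → Shape c x t → weight c x ≢ 𝟘
  shape-weight≢0 {c} {l , ds} (shape p root ch) = proj₂ (proj₂ p) [] c l root ds ch

  shape∈support : ∀ {c x t} → Shape c x t → x ∈ proj₁ (proj₂ (γ c))
  shape∈support {c} {x} s = proj₁ (proj₂ (proj₂ (proj₂ (γ c)))) x (shape-weight≢0 s)

  child-path : ∀ {c t j d l} → PathsFrom c t → t (j ∷ []) ≡ just (d , l) →
               PathsFrom d (subtree t j)
  child-path {t = t} {j} (wf , _ , nonzero) root = wf′ , (_ , root) , λ p → nonzero (j ∷ p)
    where
    wf′ : WellFormed (subtree t j)
    wf′ = record { root = _ , root
                 ; children = λ p → WellFormed.children wf (j ∷ p)
                 ; no-orphan = λ p → WellFormed.no-orphan wf (j ∷ p) }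

  cyl⊆shape : ∀ {c l} cs {Ps : Fin (ar l) → Event} →
    (∀ i → Ps i ⊆ PathsFrom (lookup cs i)) → Cyl c l Ps ⊆ Shape c (l , cs)
  cyl⊆shape _ Ps⊆Paths (p , root , ps) = shape p root λ i → proj₁ (proj₂ (Ps⊆Paths i (ps i)))

  -- A shape set is the cylinder over the full path sets (or empty).
  𝓜-shape : ∀ c x → 𝓜 c (Shape c x)
  𝓜-shape c (l , ds) with decide (weight c (l , ds) ≡ 𝟘)
  ... | yes zero-weight = 𝓜-∅ (λ s → shape-weight≢0 s zero-weight)
  ... | no nonzero = 𝓜-resp (cyl c l ds (λ i → PathsFrom (lookup ds i)) nonzero (λ i → whole _))
      (cyl⊆shape ds (λ i p → p))
      (λ (shape p root ch) → p , root , λ i → child-path p (proj₂ (ch i)))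

  -- The complement of a shape is the disjoint union of the other shapes in
  -- the (finite, duplicate-free) support of γ(c).
  𝓜-∁shape : ∀ c x → 𝓜 c (∁[ c ] Shape c x)
  𝓜-∁shape c x = 𝓜-resp (disj c (length support) Other 𝓜-Other disjoint) to from
    where
    support : List (FObj Λ ar C)
    support = proj₁ (proj₂ (γ c))
    OtherShape : FObj Λ ar C → Event
    OtherShape y t = Shape c y t × y ≢ x
    Other : Fin (length support) → Event
    Other i = OtherShape (List.lookup support i)
    𝓜-Other : ∀ i → 𝓜 c (Other i)
    𝓜-Other i with decide (List.lookup support i ≡ x)
    ... | yes y≡x = 𝓜-∅ (λ (_ , y≢x) → y≢x y≡x)
    ... | no y≢x = 𝓜-resp (𝓜-shape c _) (λ s → s , y≢x) proj₁
    disjoint : ∀ i j → i ≢ j → ∀ t → Other i t → ¬ Other j t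
    disjoint i j i≢j _ (s , _) (s′ , _) =
      i≢j (Unique-lookup-injective (proj₁ (proj₂ (proj₂ (γ c)))) i j (shape-unique s s′))
    to : ∀ {t} → (∃ λ i → Other i t) → (∁[ c ] Shape c x) t
    to (i , s , y≢x) = Shape.path s , λ s′ → y≢x (shape-unique s s′)
    from : ∀ {t} → (∁[ c ] Shape c x) t → ∃ λ i → Other i t
    from {t} (p , not-x) with path-shape p
    ... | y , s = Any.index y∈support , s′ , λ y′≡x → not-x (subst (λ z → Shape c z t) y′≡x s′)
      where
      y∈support : y ∈ support
      y∈support = shape∈support s
      s′ : Shape c (List.lookup support (Any.index y∈support)) t
      s′ = subst (λ z → Shape c z t) (lookup-index y∈support) s

  -- Intersecting a member with a cylinder, assuming intersection with each
  -- coordinate set is possible (the induction hypothesis of 𝓜-∩).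
  𝓜-∩-cyl : ∀ {c l cs} {Qs : Fin (ar l) → Event} →
    weight c (l , cs) ≢ 𝟘 → (∀ i → 𝓜 (lookup cs i) (Qs i)) →
    (∀ i {R} → 𝓜 (lookup cs i) R → 𝓜 (lookup cs i) (R ∩ Qs i)) →
    ∀ {P} → 𝓜 c P → 𝓜 c (P ∩ Cyl c l Qs)
  𝓜-∩-cyl {c} {l} {cs} {Qs} nonzero mQs _ (whole .c) =
    𝓜-resp (cyl c l cs Qs nonzero mQs) (λ q → proj₁ q , q) proj₂
  𝓜-∩-cyl {c} {l} {cs} {Qs} nonzero mQs ∩Qs (cyl .c l′ cs′ Ps _ mPs)
    with decide (_≡_ {A = FObj Λ ar C} (l′ , cs′) (l , cs))
  ... | yes refl = 𝓜-resp (cyl c l cs (λ i → Ps i ∩ Qs i) nonzero (λ i → ∩Qs i (mPs i)))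
        (λ (p , root , pqs) → (p , root , proj₁ ∘ pqs) , (p , root , proj₂ ∘ pqs))
        (λ ((p , root , ps) , (_ , _ , qs)) → p , root , λ i → ps i , qs i)
  ... | no different = 𝓜-∅ λ (inP , inQ) → different
        (shape-unique (cyl⊆shape cs′ (𝓜⊆Paths ∘ mPs) inP) (cyl⊆shape cs (𝓜⊆Paths ∘ mQs) inQ))
  𝓜-∩-cyl {c} {l} {Qs = Qs} nonzero mQs ∩Qs (disj .c k Ps m disjoint) =
    𝓜-resp (disj c k (λ i → Ps i ∩ Cyl c l Qs) (λ i → 𝓜-∩-cyl nonzero mQs ∩Qs (m i))
             (λ i j i≢j t p p′ → disjoint i j i≢j t (proj₁ p) (proj₁ p′)))
           (λ (i , p , q) → (i , p) , q) (λ ((i , p) , q) → i , p , q)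
  𝓜-∩-cyl {c} {l} {Qs = Qs} nonzero mQs ∩Qs (incr .c Ps increasing m) =
    𝓜-resp (incr c (λ n → Ps n ∩ Cyl c l Qs) (λ n (p , q) → increasing n p , q)
             (λ n → 𝓜-∩-cyl nonzero mQs ∩Qs (m n)))
           (λ (n , p , q) → (n , p) , q) (λ ((n , p) , q) → n , p , q)
  𝓜-∩-cyl {c} {l} {Qs = Qs} nonzero mQs ∩Qs (decr .c Ps decreasing m) =
    𝓜-resp (decr c (λ n → Ps n ∩ Cyl c l Qs) (λ n (p , q) → decreasing n p , q)
             (λ n → 𝓜-∩-cyl nonzero mQs ∩Qs (m n)))
           (λ pqs → proj₁ ∘ pqs , proj₂ (pqs 0)) (λ (ps , q) n → ps n , q)
  𝓜-∩-cyl nonzero mQs ∩Qs (ext c P P′ (P⊆P′ , P′⊆P) m) =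
    𝓜-resp (𝓜-∩-cyl nonzero mQs ∩Qs m) (λ (p , q) → P⊆P′ p , q) (λ (p , q) → P′⊆P p , q)

  𝓜-∩ : ∀ {c P Q} → 𝓜 c P → 𝓜 c Q → 𝓜 c (P ∩ Q)
  𝓜-∩ mP (whole c) = 𝓜-resp mP (λ p → p , 𝓜⊆Paths mP p) proj₁
  𝓜-∩ mP (cyl c l cs Qs nonzero mQs) = 𝓜-∩-cyl nonzero mQs (λ i mR → 𝓜-∩ mR (mQs i)) mP
  𝓜-∩ {P = P} mP (disj c k Qs m disjoint) =
    𝓜-resp (disj c k (λ i → P ∩ Qs i) (λ i → 𝓜-∩ mP (m i))
             (λ i j i≢j t q q′ → disjoint i j i≢j t (proj₂ q) (proj₂ q′)))
           (λ (i , p , q) → p , (i , q)) (λ (p , (i , q)) → i , p , q)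
  𝓜-∩ {P = P} mP (incr c Qs increasing m) =
    𝓜-resp (incr c (λ n → P ∩ Qs n) (λ n (p , q) → p , increasing n q) (λ n → 𝓜-∩ mP (m n)))
           (λ (n , p , q) → p , (n , q)) (λ (p , (n , q)) → n , p , q)
  𝓜-∩ {P = P} mP (decr c Qs decreasing m) =
    𝓜-resp (decr c (λ n → P ∩ Qs n) (λ n (p , q) → p , decreasing n q) (λ n → 𝓜-∩ mP (m n)))
           (λ pqs → proj₁ (pqs 0) , proj₂ ∘ pqs) (λ (p , qs) n → p , qs n)
  𝓜-∩ mP (ext c Q Q′ (Q⊆Q′ , Q′⊆Q) m) =
    𝓜-resp (𝓜-∩ mP m) (λ (p , q) → p , Q⊆Q′ q) (λ (p , q) → p , Q′⊆Q q)

  Complemented : C → Event → Set₁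
  Complemented c P = 𝓜 c P × 𝓜 c (∁[ c ] P)

  Complemented-resp : ∀ {c} {P Q : Event} → Complemented c P → P ⊆ Q → Q ⊆ P → Complemented c Q
  Complemented-resp (mP , m∁P) P⊆Q Q⊆P =
    𝓜-resp mP P⊆Q Q⊆P ,
    𝓜-resp m∁P (λ (p , ¬P) → p , ¬P ∘ Q⊆P) (λ (p , ¬Q) → p , ¬Q ∘ P⊆Q)

  -- ∁(P ∩ Q) is the disjoint union of ∁P and P ∩ ∁Q.
  Complemented-∩ : ∀ {c} {P Q : Event} → Complemented c P → Complemented c Q →
                   Complemented c (P ∩ Q)
  Complemented-∩ {c} {P} {Q} (mP , m∁P) (mQ , m∁Q) =
    𝓜-∩ mP mQ , 𝓜-resp (𝓜-⊎ m∁P (𝓜-∩ mP m∁Q) (λ (_ , ¬P) (p , _) → ¬P p)) to from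
    where
    to : ∀ {t} → (∁[ c ] P) t ⊎ (P ∩ ∁[ c ] Q) t → (∁[ c ] (P ∩ Q)) t
    to (inj₁ (p , ¬P)) = p , ¬P ∘ proj₁
    to (inj₂ (_ , p , ¬Q)) = p , ¬Q ∘ proj₂
    from : ∀ {t} → (∁[ c ] (P ∩ Q)) t → (∁[ c ] P) t ⊎ (P ∩ ∁[ c ] Q) t
    from {t} (p , ¬PQ) with decide (P t)
    ... | yes inP = inj₂ (inP , p , λ q → ¬PQ (inP , q))
    ... | no ¬P = inj₁ (p , ¬P)

  module CylinderComplement {c : C} {l : Λ} {cs : Vec C (ar l)}
                            (nonzero : weight c (l , cs) ≢ 𝟘) where

    Only : Fin (ar l) → (Fin (ar l) → Event) → Fin (ar l) → Event
    Only i Qs j t = PathsFrom (lookup cs j) t × (j ≡ i → Qs j t)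

    𝓜-Only : ∀ i {Qs} → 𝓜 (lookup cs i) (Qs i) → ∀ j → 𝓜 (lookup cs j) (Only i Qs j)
    𝓜-Only i mQ j with j ≟ᶠ i
    ... | yes refl = 𝓜-resp mQ (λ q → 𝓜⊆Paths mQ q , λ _ → q) (λ (_ , q) → q refl)
    ... | no j≢i = 𝓜-resp (whole _) (λ p → p , ⊥-elim ∘ j≢i) proj₁

    -- A one-coordinate cylinder is complemented: its complement consists of
    -- the paths of another shape and those of shape (l , cs) whose i-th
    -- child lies outside Ps i.
    Complemented-Only : ∀ {Ps} i → Complemented (lookup cs i) (Ps i) →
                        Complemented c (Cyl c l (Only i Ps))
    Complemented-Only {Ps} i (mPᵢ , m∁Pᵢ) =
      cyl c l cs (Only i Ps) nonzero (𝓜-Only i mPᵢ) ,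
      𝓜-resp (𝓜-⊎ (𝓜-∁shape c (l , cs)) (cyl c l cs (Only i ∁Ps) nonzero (𝓜-Only i m∁Pᵢ))
                   (λ (_ , ¬shape) d → ¬shape (cyl⊆shape cs {Only i ∁Ps} (λ _ → proj₁) d)))
             to from
      where
      ∁Ps : Fin (ar l) → Event
      ∁Ps j = ∁[ lookup cs j ] Ps j
      to : ∀ {t} → (∁[ c ] Shape c (l , cs)) t ⊎ Cyl c l (Only i ∁Ps) t →
           (∁[ c ] Cyl c l (Only i Ps)) t
      to (inj₁ (p , ¬shape)) = p , λ d → ¬shape (cyl⊆shape cs {Only i Ps} (λ _ → proj₁) d)
      to (inj₂ (p , _ , outside)) =
        p , λ (_ , _ , inside) → proj₂ (proj₂ (outside i) refl) (proj₂ (inside i) refl)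
      from : ∀ {t} → (∁[ c ] Cyl c l (Only i Ps)) t →
             (∁[ c ] Shape c (l , cs)) t ⊎ Cyl c l (Only i ∁Ps) t
      from {t} (p , ¬cyl) with decide (Shape c (l , cs) t)
      ... | no ¬shape = inj₁ (p , ¬shape)
      ... | yes (shape _ root ch) =
        inj₂ (p , root , λ j → child j , λ { refl → child j , λ pᵢ →
               ¬cyl (p , root , λ j′ → child j′ , λ { refl → pᵢ }) })
        where
        child : ∀ j → PathsFrom (lookup cs j) (subtree t (toℕ j))
        child j = child-path p (proj₂ (ch j))

    -- A cylinder is its shape intersected with its one-coordinate
    -- cylinders, so its complement follows from Complemented-∩.
    𝓜-∁cyl : ∀ {Ps} → (∀ i → Complemented (lookup cs i) (Ps i)) → 𝓜 c (∁[ c ] Cyl c l Ps)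
    𝓜-∁cyl {Ps} cPs = proj₂ (Complemented-resp
        (⋂-fin {𝒜 = Complemented c} Complemented-resp Complemented-∩ (ar l)
               (λ i → Cyl c l (Only i Ps)) (𝓜-shape c (l , cs) , 𝓜-∁shape c (l , cs))
               (λ i → Complemented-Only {Ps} i (cPs i)))
        (λ ((shape p root _) , cyls) → p , root , λ i → proj₂ (proj₂ (proj₂ (cyls i)) i) refl)
        (λ d@(p , root , ps) → cyl⊆shape cs Ps⊆Paths d ,
                              λ i → p , root , λ j → Ps⊆Paths j (ps j) , λ _ → ps j))
      where
      Ps⊆Paths : ∀ j → Ps j ⊆ PathsFrom (lookup cs j)
      Ps⊆Paths j = 𝓜⊆Paths (proj₁ (cPs j))

  -- Double negation elimination and its consequence for ∀ over ℕ, needed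
  -- to complement a decreasing intersection.
  stable : ∀ {X : Set} → ¬ ¬ X → X
  stable = em⇒dne (λ {Y} → em {0ℓ} {Y})

  ¬∀⇒∃¬ : ∀ {P : ℕ → Set} → ¬ (∀ n → P n) → ∃ λ n → ¬ P n
  ¬∀⇒∃¬ ¬∀ = stable λ ¬∃ → ¬∀ λ n → stable λ ¬Pn → ¬∃ (n , ¬Pn)

  𝓜-∁ : ∀ {c P} → 𝓜 c P → 𝓜 c (∁[ c ] P)
  𝓜-∁ (whole c) = 𝓜-∅ (λ (p , ¬p) → ¬p p)
  𝓜-∁ (cyl c l cs Ps nonzero mPs) =
    CylinderComplement.𝓜-∁cyl nonzero (λ i → mPs i , 𝓜-∁ (mPs i))
  𝓜-∁ (disj c k Ps m _) =
    𝓜-resp (⋂-fin {𝒜 = 𝓜 c} 𝓜-resp 𝓜-∩ k (λ i → ∁[ c ] Ps i) (whole c) (λ i → 𝓜-∁ (m i)))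
           (λ (p , ∁ps) → p , λ (i , q) → proj₂ (∁ps i) q)
           (λ (p , ¬⋃) → p , λ i → p , λ q → ¬⋃ (i , q))
  𝓜-∁ (incr c Ps increasing m) =
    𝓜-resp (decr c (λ n → ∁[ c ] Ps n) (λ n (p , ¬q) → p , ¬q ∘ increasing n) (λ n → 𝓜-∁ (m n)))
           (λ ∁ps → proj₁ (∁ps 0) , λ (n , q) → proj₂ (∁ps n) q)
           (λ (p , ¬⋃) n → p , λ q → ¬⋃ (n , q))
  𝓜-∁ (decr c Ps decreasing m) =
    𝓜-resp (incr c (λ n → ∁[ c ] Ps n) (λ n (p , ¬q) → p , ¬q ∘ decreasing n) (λ n → 𝓜-∁ (m n)))
           (λ (n , p , ¬q) → p , λ qs → ¬q (qs n))
           (λ (p , ¬⋂) → let (n , ¬q) = ¬∀⇒∃¬ ¬⋂ in n , p , ¬q)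
  𝓜-∁ (ext c P Q (P⊆Q , Q⊆P) m) =
    𝓜-resp (𝓜-∁ m) (λ (p , ¬P) → p , ¬P ∘ Q⊆P) (λ (p , ¬Q) → p , ¬Q ∘ P⊆Q)

  -- ⋃ₙ Pₙ is the increasing union of the partial unions Bₙ = P₀ ∪ … ∪ Pₙ,
  -- each built as the disjoint union Bₙ₊₁ = Bₙ ⊎ (Pₙ₊₁ ∖ Bₙ).
  𝓜-⋃ : ∀ {c} (P : ℕ → Event) → (∀ n → 𝓜 c (P n)) → 𝓜 c (λ t → ∃ λ n → P n t)
  𝓜-⋃ {c} P mP = 𝓜-resp (incr c B (λ _ → inj₁) mB) (λ (n , b) → B⊆⋃ n b) (λ (n , q) → n , P⊆B n q)
    where
    B : ℕ → Event
    B zero = P zero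
    B (suc n) t = B n t ⊎ P (suc n) t
    B⊆⋃ : ∀ n {t} → B n t → ∃ λ k → P k t
    B⊆⋃ zero p = 0 , p
    B⊆⋃ (suc n) (inj₁ b) = B⊆⋃ n b
    B⊆⋃ (suc n) (inj₂ p) = suc n , p
    P⊆B : ∀ n {t} → P n t → B n t
    P⊆B zero p = p
    P⊆B (suc n) p = inj₂ p
    mB : ∀ n → 𝓜 c (B n)
    mB zero = mP 0
    mB (suc n) = 𝓜-resp (𝓜-⊎ (mB n) (𝓜-∩ (𝓜-∁ (mB n)) (mP (suc n))) (λ b ((_ , ¬b) , _) → ¬b b))
                        to from
      where
      to : ∀ {t} → B n t ⊎ (∁[ c ] B n ∩ P (suc n)) t → B (suc n) t
      to (inj₁ b) = inj₁ b
      to (inj₂ (_ , p)) = inj₂ p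
      from : ∀ {t} → B (suc n) t → B n t ⊎ (∁[ c ] B n ∩ P (suc n)) t
      from (inj₁ b) = inj₁ b
      from {t} (inj₂ p) with decide (B n t)
      ... | yes b = inj₁ b
      ... | no ¬b = inj₂ ((𝓜⊆Paths (mP (suc n)) p , ¬b) , p)

corollary4p9 : (∀ {ℓ} → ExcludedMiddle ℓ) →
    (𝕊 : PCSemiring) → Standing 𝕊 →
    (Λ : Set) (ar : Λ → ℕ) (C : Set) (γ : C → TS 𝕊 (FObj Λ ar C)) (c : C) →
    IsSigmaAlgebra (Paths.PathsFrom 𝕊 ar γ c) (Paths.𝓜 𝕊 ar γ c)
corollary4p9 em 𝕊 _ _ ar _ γ c = record
  { subsets = λ _ → 𝓜⊆Paths
  ; whole   = Paths.whole c
  ; compl   = λ _ → 𝓜-∁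
  ; ⋃-count = 𝓜-⋃ }
  where open SigmaAlgebra em 𝕊 ar γ
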